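{- Let $\mathcal{P}$ be a $d$-dimensional integral polytope with Ehrhart polynomial $i(\mathcal{P},t)=1+\sum_{i=1}^{d}c_it^i$, where $c_i\neq 0$ for every $i$. Then there exist two $(d+1)$-dimensional integral polytopes $\mathcal{Q}_1$ and $\mathcal{Q}_2$ with Ehrhart polynomials $i(\mathcal{Q}_1,t)=1+\sum_{i=1}^{d+1}h_it^i$ and $i(\mathcal{Q}_2,t)=1+\sum_{i=1}^{d+1}g_it^i$ such that $\mathrm{sgn}(h_i)=\mathrm{sgn}(c_i)$ for all $1\le i\le d-1$ (in particular $\mathrm{sgn}(h_{d-1})=+1$), and $\mathrm{sgn}(g_i)=\mathrm{sgn}(c_{i-1})$ for all $2\le i\le d-1$ and $\mathrm{sgn}(g_1)=+1$.
   Context: An integral polytope is a convex polytope all of whose vertices have integer coordinates. For an integral polytope $\mathcal{P}\subseteq\mathbb{R}^N$ of dimension $d$, $i(\mathcal{P},t)=|t\mathcal{P}\cap\mathbb{Z}^N|$ ($t$ a positive integer) is a polynomial in $t$ of degree $d$ with constant term $1$, the Ehrhart polynomial. $\mathrm{sgn}(x)\in\{ -1,0,+1\}$ denotes the sign of a real number $x$, with $\mathrm{sgn}(0)=0$. -}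

module Defs where

open import Data.Nat as ℕ using (ℕ; zero; suc)
open import Data.Integer as ℤ using (ℤ; +_; -[1+_])
open import Data.Rational using (ℚ; 0ℚ; 1ℚ; _+_; _*_; _/_; _≤_; mkℚ)
open import Data.Vec using (Vec; []; _∷_; map; zipWith; replicate)
open import Data.Vec.Relation.Unary.All using (All)
open import Data.Vec.Membership.Propositional using () renaming (_∈_ to _∈ᵥ_)
open import Data.List using (List; length)
open import Data.List.Membership.Propositional using (_∈_)
open import Data.List.Relation.Unary.Unique.Propositional using (Unique)
open import Data.Product using (Σ; _×_)
open import Relation.Binary.PropositionalEquality using (_≡_)
open import Relation.Nullary using (¬_)

ℤ→ℚ : ℤ → ℚ
ℤ→ℚ z = z / 1

ℕ→ℚ : ℕ → ℚ
ℕ→ℚ n = (+ n) / 1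

_^ℚ_ : ℚ → ℕ → ℚ
q ^ℚ zero = 1ℚ
q ^ℚ suc n = q * (q ^ℚ n)

toℚv : ∀ {N} → Vec ℤ N → Vec ℚ N
toℚv = map ℤ→ℚ

sumℚ : ∀ {k} → Vec ℚ k → ℚ
sumℚ [] = 0ℚ
sumℚ (a ∷ as) = a + sumℚ as

lincomb : ∀ {N k} → Vec ℚ k → Vec (Vec ℚ N) k → Vec ℚ N
lincomb {N} [] [] = replicate N 0ℚ
lincomb (a ∷ as) (p ∷ ps) = zipWith _+_ (map (a *_) p) (lincomb as ps)

-- An integral polytope in ℝ^N is given as conv(V) for a nonempty finite
-- list V of lattice points (k = number of points).
-- x ∈ t·conv(V)  (x a lattice point, t a natural number):
-- x = Σ λ_j v_j with λ_j ≥ 0 and Σ λ_j = t.  Since V and x are rational,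
-- real and rational coefficients give the same condition.
InDilate : ∀ {N k} → Vec (Vec ℤ N) k → ℕ → Vec ℤ N → Set
InDilate {N} {k} V t x =
  Σ (Vec ℚ k) λ lam →
    All (0ℚ ≤_) lam × sumℚ lam ≡ ℕ→ℚ t × lincomb lam (map toℚv V) ≡ toℚv x

LatticeCount : ∀ {N k} → Vec (Vec ℤ N) k → ℕ → ℕ → Set
LatticeCount {N} V t n =
  Σ (List (Vec ℤ N)) λ L →
    Unique L × Data.List.Relation.Unary.All.All (InDilate V t) L
      × (∀ x → InDilate V t x → x ∈ L) × length L ≡ n
  where import Data.List.Relation.Unary.All

AffinelyIndependent : ∀ {N m} → Vec (Vec ℚ N) m → Set
AffinelyIndependent {N} {m} ps =
  ∀ (μ : Vec ℚ m) → sumℚ μ ≡ 0ℚ → lincomb μ ps ≡ replicate N 0ℚ →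
    All (_≡ 0ℚ) μ

HasDim : ∀ {N k} → Vec (Vec ℤ N) k → ℕ → Set
HasDim {N} V d =
  (Σ (Vec (Vec ℤ N) (suc d)) λ S →
     All (_∈ᵥ V) S × AffinelyIndependent (map toℚv S))
  × (∀ (S : Vec (Vec ℤ N) (suc (suc d))) → All (_∈ᵥ V) S →
       ¬ AffinelyIndependent (map toℚv S))

ehrPoly : (ℕ → ℚ) → ℕ → ℚ → ℚ
ehrPoly c zero t = 1ℚ
ehrPoly c (suc i) t = ehrPoly c i t + c (suc i) * (t ^ℚ suc i)

HasEhrhart : ∀ {N k} → Vec (Vec ℤ N) k → ℕ → (ℕ → ℚ) → Set
HasEhrhart V d c =
  ∀ (t : ℕ) → 1 ℕ.≤ t →
    Σ ℕ λ n → LatticeCount V t n × ℕ→ℚ n ≡ ehrPoly c d (ℕ→ℚ t)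

sgn : ℚ → ℤ
sgn q with ℚ.numerator q
... | + zero = + 0
... | + suc _ = + 1
... | -[1+ _ ] = ℤ.- (+ 1)
  where open Data.Rational using (ℚ)

IntegralPolytopeWithEhrhart : ℕ → (ℕ → ℚ) → Set
IntegralPolytopeWithEhrhart d c =
  Σ ℕ λ N → Σ ℕ λ k → Σ (Vec (Vec ℤ N) (suc k)) λ V →
    HasDim V d × HasEhrhart V d c

{-# OPTIONS --safe #-}
-- The prism Q = [0, b] × aP over a d-dimensional lattice polytope P is a
-- (d + 1)-dimensional lattice polytope with i(Q, t) = (1 + bt) · i(P, at), so
-- with c₀ = 1 its Ehrhart coefficients are aⁱcᵢ + b·aⁱ⁻¹cᵢ₋₁.  For (a, b) = (M, 1)
-- this is Mⁱ⁻¹(Mcᵢ + cᵢ₋₁), for (a, b) = (1, M) it is Mcᵢ₋₁ + cᵢ, and once the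
-- integer M outweighs every ratio |cⱼ / cᵢ| both take the sign of the M-term.
module Submission where

open import Data.Nat as ℕ using (ℕ; zero; suc; z≤n; s≤s; _≤_; _<_; _∸_)
import Data.Nat.Properties as ℕ
open import Data.Nat.Coprimality using (1-coprimeTo) renaming (sym to coprime-sym)
open import Data.Integer as ℤ using (ℤ; +_; -[1+_]; +[1+_])
import Data.Integer.Properties as ℤ
open import Data.Rational as ℚ hiding (_≤_; _<_)
open import Data.Rational.Properties
open import Data.Rational.Solver
import Data.Rational.Unnormalised as ℚᵘ
import Data.Rational.Unnormalised.Properties as ℚᵘ
open import Data.Fin as Fin using (Fin; zero; suc)
open import Data.Vec as Vec using (Vec; []; _∷_; map; zipWith; replicate; _++_; insertAt; removeAt; lookup)
import Data.Vec.Properties as Vec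
open import Data.Vec.Relation.Unary.All as All using (All; []; _∷_)
import Data.Vec.Relation.Unary.All.Properties as All
import Data.Vec.Relation.Unary.Any.Properties as Any
open import Data.Vec.Membership.Propositional using (find) renaming (_∈_ to _∈ᵥ_)
open import Data.Vec.Membership.Propositional.Properties using (∈-map⁺; ∈-++⁺ˡ; ∈-++⁺ʳ)
open import Data.Product using (Σ; ∃-syntax; _×_; _,_; proj₁; proj₂)
open import Data.Sum using (inj₁; inj₂)
open import Data.List as List using (List; length; cartesianProductWith; upTo)
import Data.List.Properties as List
import Data.List.Relation.Unary.All as ListAll
open import Data.List.Membership.Propositional using (_∈_)
open import Data.List.Membership.Propositional.Properties
  using (∈-cartesianProductWith⁺; ∈-cartesianProductWith⁻; ∈-upTo⁺; ∈-upTo⁻)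
import Data.List.Relation.Unary.Unique.Propositional.Properties as Unique
open import Function using (_∘_)
open import Relation.Nullary using (¬_; yes; no; contradiction)
open import Relation.Binary using (tri<; tri≈; tri>)
open import Relation.Nullary.Decidable using (decidable-stable)
open import Relation.Binary.PropositionalEquality
open import Defs

open +-*-Solver

private variable
  k n N : ℕ

-- ℤ→ℚ z = z / 1 is stuck on a variable z; its normal form mkℚ z 0 computes.
ℤ→ℚ≡mkℚ : ∀ z → ℤ→ℚ z ≡ mkℚ z 0 (coprime-sym (1-coprimeTo ℤ.∣ z ∣))
ℤ→ℚ≡mkℚ z = ↥p/↧p≡p (mkℚ z 0 _)

ℤ→ℚ-+ : ∀ z w → ℤ→ℚ (z ℤ.+ w) ≡ ℤ→ℚ z + ℤ→ℚ w
ℤ→ℚ-+ z w rewrite ℤ→ℚ≡mkℚ z | ℤ→ℚ≡mkℚ w =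
  cong₂ (λ u v → (u ℤ.+ v) / 1) (sym (ℤ.*-identityʳ z)) (sym (ℤ.*-identityʳ w))

ℤ→ℚ-* : ∀ z w → ℤ→ℚ (z ℤ.* w) ≡ ℤ→ℚ z * ℤ→ℚ w
ℤ→ℚ-* z w rewrite ℤ→ℚ≡mkℚ z | ℤ→ℚ≡mkℚ w = refl

ℤ→ℚ-mono-≤ : ∀ {z w} → z ℤ.≤ w → ℤ→ℚ z ℚ.≤ ℤ→ℚ w
ℤ→ℚ-mono-≤ {z} {w} z≤w rewrite ℤ→ℚ≡mkℚ z | ℤ→ℚ≡mkℚ w =
  *≤* (subst₂ ℤ._≤_ (sym (ℤ.*-identityʳ z)) (sym (ℤ.*-identityʳ w)) z≤w)

ℤ→ℚ-cancel-≤ : ∀ {z w} → ℤ→ℚ z ℚ.≤ ℤ→ℚ w → z ℤ.≤ w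
ℤ→ℚ-cancel-≤ {z} {w} z≤w rewrite ℤ→ℚ≡mkℚ z | ℤ→ℚ≡mkℚ w with z≤w
... | *≤* z*1≤w*1 = subst₂ ℤ._≤_ (ℤ.*-identityʳ z) (ℤ.*-identityʳ w) z*1≤w*1

ℤ→ℚ-mono-< : ∀ {z w} → z ℤ.< w → ℤ→ℚ z ℚ.< ℤ→ℚ w
ℤ→ℚ-mono-< {z} {w} z<w rewrite ℤ→ℚ≡mkℚ z | ℤ→ℚ≡mkℚ w =
  *<* (subst₂ ℤ._<_ (sym (ℤ.*-identityʳ z)) (sym (ℤ.*-identityʳ w)) z<w)

ℕ→ℚ-+ : ∀ m n → ℕ→ℚ (m ℕ.+ n) ≡ ℕ→ℚ m + ℕ→ℚ n
ℕ→ℚ-+ m n = trans (cong ℤ→ℚ (ℤ.pos-+ m n)) (ℤ→ℚ-+ (+ m) (+ n))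

ℕ→ℚ-* : ∀ m n → ℕ→ℚ (m ℕ.* n) ≡ ℕ→ℚ m * ℕ→ℚ n
ℕ→ℚ-* m n = trans (cong ℤ→ℚ (ℤ.pos-* m n)) (ℤ→ℚ-* (+ m) (+ n))

ℕ→ℚ-mono-≤ : ∀ {m n} → m ≤ n → ℕ→ℚ m ℚ.≤ ℕ→ℚ n
ℕ→ℚ-mono-≤ {m} {n} m≤n = ℤ→ℚ-mono-≤ {+ m} {+ n} (ℤ.+≤+ m≤n)

ℕ→ℚ-nonNeg : ∀ n → 0ℚ ℚ.≤ ℕ→ℚ n
ℕ→ℚ-nonNeg n = ℕ→ℚ-mono-≤ {0} {n} z≤n

ℕ→ℚ-pos : ∀ n → 0ℚ ℚ.< ℕ→ℚ (suc n)
ℕ→ℚ-pos n = ℤ→ℚ-mono-< {+ 0} {+ suc n} (ℤ.+<+ (s≤s z≤n))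

ℕ→ℚ-suc≢0 : ∀ n → ℕ→ℚ (suc n) ≢ 0ℚ
ℕ→ℚ-suc≢0 n = ≢-sym (<⇒≢ (ℕ→ℚ-pos n))

nonNeg-+ : ∀ {x y} → 0ℚ ℚ.≤ x → 0ℚ ℚ.≤ y → 0ℚ ℚ.≤ x + y
nonNeg-+ {x} {y} 0≤x 0≤y =
  nonNegative⁻¹ _ {{nonNeg+nonNeg⇒nonNeg x {{nonNegative 0≤x}} y {{nonNegative 0≤y}}}}

nonNeg-* : ∀ {x y} → 0ℚ ℚ.≤ x → 0ℚ ℚ.≤ y → 0ℚ ℚ.≤ x * y
nonNeg-* {x} {y} 0≤x 0≤y =
  nonNegative⁻¹ _ {{nonNeg*nonNeg⇒nonNeg x {{nonNegative 0≤x}} y {{nonNegative 0≤y}}}}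

x*y≡0⇒x≡0 : ∀ {x y} → y ≢ 0ℚ → x * y ≡ 0ℚ → x ≡ 0ℚ
x*y≡0⇒x≡0 {x} {y} y≢0 xy≡0 = begin
  x                ≡⟨ sym (*-identityʳ x) ⟩
  x * 1ℚ           ≡⟨ cong (x *_) (sym (*-inverseʳ y)) ⟩
  x * (y * 1/ y)   ≡⟨ sym (*-assoc x y (1/ y)) ⟩
  x * y * 1/ y     ≡⟨ cong (_* 1/ y) xy≡0 ⟩
  0ℚ * 1/ y        ≡⟨ *-zeroˡ (1/ y) ⟩
  0ℚ               ∎
  where
  open ≡-Reasoning
  instance _ = ≢-nonZero y≢0

infixl 6 _⊕_
infixr 7 _·_

_⊕_ : Vec ℚ n → Vec ℚ n → Vec ℚ n
_⊕_ = zipWith _+_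

_·_ : ℚ → Vec ℚ n → Vec ℚ n
c · v = map (c *_) v

0ᵛ : ∀ n → Vec ℚ n
0ᵛ n = replicate n 0ℚ

dot : Vec ℚ n → Vec ℚ n → ℚ
dot []       []       = 0ℚ
dot (a ∷ as) (z ∷ zs) = a * z + dot as zs

⊕-identityˡ : (v : Vec ℚ n) → 0ᵛ n ⊕ v ≡ v
⊕-identityˡ = Vec.zipWith-identityˡ +-identityˡ

⊕-assoc : (u v w : Vec ℚ n) → (u ⊕ v) ⊕ w ≡ u ⊕ (v ⊕ w)
⊕-assoc = Vec.zipWith-assoc +-assoc

⊕-interchange : (u v w x : Vec ℚ n) → (u ⊕ v) ⊕ (w ⊕ x) ≡ (u ⊕ w) ⊕ (v ⊕ x)
⊕-interchange []       []       []       []       = refl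
⊕-interchange (u ∷ us) (v ∷ vs) (w ∷ ws) (x ∷ xs) = cong₂ _∷_
  (solve 4 (λ u v w x → (u :+ v) :+ (w :+ x) := (u :+ w) :+ (v :+ x)) refl u v w x)
  (⊕-interchange us vs ws xs)

·-distribˡ-⊕ : ∀ c (u v : Vec ℚ n) → c · (u ⊕ v) ≡ c · u ⊕ c · v
·-distribˡ-⊕ c []       []       = refl
·-distribˡ-⊕ c (u ∷ us) (v ∷ vs) = cong₂ _∷_ (*-distribˡ-+ c u v) (·-distribˡ-⊕ c us vs)

·-distribʳ-+ : ∀ c d (v : Vec ℚ n) → (c + d) · v ≡ c · v ⊕ d · v
·-distribʳ-+ c d []       = refl
·-distribʳ-+ c d (v ∷ vs) = cong₂ _∷_ (*-distribʳ-+ v c d) (·-distribʳ-+ c d vs)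

·-assoc : ∀ c d (v : Vec ℚ n) → c · d · v ≡ (c * d) · v
·-assoc c d v = trans (sym (Vec.map-∘ (c *_) (d *_) v)) (Vec.map-cong (λ x → sym (*-assoc c d x)) v)

·-identityˡ : (v : Vec ℚ n) → 1ℚ · v ≡ v
·-identityˡ v = trans (Vec.map-cong *-identityˡ v) (Vec.map-id v)

·-zeroˡ : (v : Vec ℚ n) → 0ℚ · v ≡ 0ᵛ n
·-zeroˡ v = trans (Vec.map-cong *-zeroˡ v) (Vec.map-const v 0ℚ)

·-zeroʳ : ∀ c → c · 0ᵛ n ≡ 0ᵛ n
·-zeroʳ {n} c = trans (Vec.map-replicate (c *_) 0ℚ n) (cong (replicate n) (*-zeroʳ c))

·-comm : ∀ c d (v : Vec ℚ n) → c · d · v ≡ d · c · v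
·-comm c d v = trans (·-assoc c d v) (trans (cong (_· v) (*-comm c d)) (sym (·-assoc d c v)))

lincomb-⊕ : (l m : Vec ℚ k) (P : Vec (Vec ℚ N) k) → lincomb (l ⊕ m) P ≡ lincomb l P ⊕ lincomb m P
lincomb-⊕ []      []      []      = sym (⊕-identityˡ _)
lincomb-⊕ (a ∷ l) (b ∷ m) (p ∷ P) = begin
  (a + b) · p ⊕ lincomb (l ⊕ m) P                 ≡⟨ cong₂ _⊕_ (·-distribʳ-+ a b p) (lincomb-⊕ l m P) ⟩
  (a · p ⊕ b · p) ⊕ (lincomb l P ⊕ lincomb m P)   ≡⟨ ⊕-interchange (a · p) (b · p) _ _ ⟩
  (a · p ⊕ lincomb l P) ⊕ (b · p ⊕ lincomb m P)   ∎
  where open ≡-Reasoning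

lincomb-· : ∀ c (l : Vec ℚ k) (P : Vec (Vec ℚ N) k) → lincomb (c · l) P ≡ c · lincomb l P
lincomb-· c []      []      = sym (·-zeroʳ c)
lincomb-· c (a ∷ l) (p ∷ P) = begin
  (c * a) · p ⊕ lincomb (c · l) P   ≡⟨ cong₂ _⊕_ (sym (·-assoc c a p)) (lincomb-· c l P) ⟩
  c · a · p ⊕ c · lincomb l P       ≡⟨ sym (·-distribˡ-⊕ c _ _) ⟩
  c · (a · p ⊕ lincomb l P)         ∎
  where open ≡-Reasoning

lincomb-map-· : ∀ c (l : Vec ℚ k) (P : Vec (Vec ℚ N) k) → lincomb l (map (c ·_) P) ≡ c · lincomb l P
lincomb-map-· c []      []      = sym (·-zeroʳ c)
lincomb-map-· c (a ∷ l) (p ∷ P) = begin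
  a · c · p ⊕ lincomb l (map (c ·_) P)   ≡⟨ cong₂ _⊕_ (·-comm a c p) (lincomb-map-· c l P) ⟩
  c · a · p ⊕ c · lincomb l P             ≡⟨ sym (·-distribˡ-⊕ c _ _) ⟩
  c · (a · p ⊕ lincomb l P)               ∎
  where open ≡-Reasoning

lincomb-++ : (l : Vec ℚ k) (m : Vec ℚ n) (P : Vec (Vec ℚ N) k) (Q : Vec (Vec ℚ N) n) →
             lincomb (l ++ m) (P ++ Q) ≡ lincomb l P ⊕ lincomb m Q
lincomb-++ []      m []      Q = sym (⊕-identityˡ _)
lincomb-++ (a ∷ l) m (p ∷ P) Q = trans (cong (a · p ⊕_) (lincomb-++ l m P Q)) (sym (⊕-assoc _ _ _))

lincomb-zipWith-∷ : (l ζ : Vec ℚ k) (P : Vec (Vec ℚ N) k) →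
                    lincomb l (zipWith _∷_ ζ P) ≡ dot l ζ ∷ lincomb l P
lincomb-zipWith-∷ []      []      []      = refl
lincomb-zipWith-∷ (a ∷ l) (z ∷ ζ) (p ∷ P) = cong (zipWith _+_ (a · (z ∷ p))) (lincomb-zipWith-∷ l ζ P)

lincomb-insertAt-0 : (μ : Vec ℚ n) (P : Vec (Vec ℚ N) (suc n)) (j : Fin (suc n)) →
                     lincomb (insertAt μ j 0ℚ) P ≡ lincomb μ (removeAt P j)
lincomb-insertAt-0 μ       (p ∷ P)          zero    = trans (cong (_⊕ lincomb μ P) (·-zeroˡ p)) (⊕-identityˡ _)
lincomb-insertAt-0 (m ∷ μ) (p ∷ P@(_ ∷ _)) (suc j) = cong (m · p ⊕_) (lincomb-insertAt-0 μ P j)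

sumℚ-⊕ : (l m : Vec ℚ k) → sumℚ (l ⊕ m) ≡ sumℚ l + sumℚ m
sumℚ-⊕ []      []      = refl
sumℚ-⊕ (a ∷ l) (b ∷ m) = trans (cong (_+_ (a + b)) (sumℚ-⊕ l m))
  (solve 4 (λ a b x y → (a :+ b) :+ (x :+ y) := (a :+ x) :+ (b :+ y)) refl a b (sumℚ l) (sumℚ m))

sumℚ-· : ∀ c (l : Vec ℚ k) → sumℚ (c · l) ≡ c * sumℚ l
sumℚ-· c []      = sym (*-zeroʳ c)
sumℚ-· c (a ∷ l) = trans (cong (_+_ (c * a)) (sumℚ-· c l)) (sym (*-distribˡ-+ c a (sumℚ l)))

sumℚ-++ : (l : Vec ℚ k) (m : Vec ℚ n) → sumℚ (l ++ m) ≡ sumℚ l + sumℚ m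
sumℚ-++ []      m = sym (+-identityˡ _)
sumℚ-++ (a ∷ l) m = trans (cong (_+_ a) (sumℚ-++ l m)) (sym (+-assoc a (sumℚ l) (sumℚ m)))

sumℚ-insertAt-0 : (μ : Vec ℚ n) (j : Fin (suc n)) → sumℚ (insertAt μ j 0ℚ) ≡ sumℚ μ
sumℚ-insertAt-0 μ       zero    = +-identityˡ _
sumℚ-insertAt-0 (m ∷ μ) (suc j) = cong (_+_ m) (sumℚ-insertAt-0 μ j)

All-nonNeg-⊕ : {l m : Vec ℚ k} → All (0ℚ ℚ.≤_) l → All (0ℚ ℚ.≤_) m → All (0ℚ ℚ.≤_) (l ⊕ m)
All-nonNeg-⊕ []         []         = []
All-nonNeg-⊕ (0≤a ∷ 0≤l) (0≤b ∷ 0≤m) = nonNeg-+ 0≤a 0≤b ∷ All-nonNeg-⊕ 0≤l 0≤m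

All-nonNeg-· : ∀ {c} {l : Vec ℚ k} → 0ℚ ℚ.≤ c → All (0ℚ ℚ.≤_) l → All (0ℚ ℚ.≤_) (c · l)
All-nonNeg-· 0≤c []          = []
All-nonNeg-· 0≤c (0≤a ∷ 0≤l) = nonNeg-* 0≤c 0≤a ∷ All-nonNeg-· 0≤c 0≤l

sumℚ-nonNeg : {l : Vec ℚ k} → All (0ℚ ℚ.≤_) l → 0ℚ ℚ.≤ sumℚ l
sumℚ-nonNeg []          = ≤-refl
sumℚ-nonNeg (0≤a ∷ 0≤l) = nonNeg-+ 0≤a (sumℚ-nonNeg 0≤l)

dot-⊕ : (l m ζ : Vec ℚ k) → dot (l ⊕ m) ζ ≡ dot l ζ + dot m ζ
dot-⊕ []      []      []      = refl
dot-⊕ (a ∷ l) (b ∷ m) (z ∷ ζ) = trans (cong (_+_ ((a + b) * z)) (dot-⊕ l m ζ))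
  (solve 5 (λ a b z x y → (a :+ b) :* z :+ (x :+ y) := (a :* z :+ x) :+ (b :* z :+ y))
     refl a b z (dot l ζ) (dot m ζ))

dot-· : ∀ c (l ζ : Vec ℚ k) → dot (c · l) ζ ≡ c * dot l ζ
dot-· c []      []      = sym (*-zeroʳ c)
dot-· c (a ∷ l) (z ∷ ζ) = trans (cong (_+_ (c * a * z)) (dot-· c l ζ))
  (solve 4 (λ c a z x → c :* a :* z :+ c :* x := c :* (a :* z :+ x)) refl c a z (dot l ζ))

dot-replicate : ∀ (l : Vec ℚ k) z → dot l (replicate k z) ≡ z * sumℚ l
dot-replicate []      z = sym (*-zeroʳ z)
dot-replicate (a ∷ l) z = trans (cong (_+_ (a * z)) (dot-replicate l z))
  (solve 3 (λ a z x → a :* z :+ z :* x := z :* (a :+ x)) refl a z (sumℚ l))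

·-cancel : ∀ {c} (v : Vec ℚ n) → c ≢ 0ℚ → c · v ≡ 0ᵛ n → v ≡ 0ᵛ n
·-cancel []       c≢0 c·v≡0 = refl
·-cancel {c = c} (x ∷ xs) c≢0 c·v≡0 = cong₂ _∷_
  (x*y≡0⇒x≡0 c≢0 (trans (*-comm x c) (Vec.∷-injectiveˡ c·v≡0)))
  (·-cancel xs c≢0 (Vec.∷-injectiveʳ c·v≡0))

record IsAffineDependence (ps : Vec (Vec ℚ N) k) (μ : Vec ℚ k) : Set where
  constructor _,_
  field
    sum≡0     : sumℚ μ ≡ 0ℚ
    lincomb≡0 : lincomb μ ps ≡ 0ᵛ N

Nontrivial : Vec ℚ k → Set
Nontrivial μ = ∃[ j ] lookup μ j ≢ 0ℚ

independent⇒trivial : {ps : Vec (Vec ℚ N) k} {μ : Vec ℚ k} →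
                      AffinelyIndependent ps → IsAffineDependence ps μ → ¬ Nontrivial μ
independent⇒trivial {μ = μ} ind (Σμ≡0 , lμ≡0) (j , μj≢0) = μj≢0 (All.lookup⁺ (ind μ Σμ≡0 lμ≡0) j)

¬independent⇒¬¬dependence : (ps : Vec (Vec ℚ N) k) → ¬ AffinelyIndependent ps →
                             ¬ ¬ (∃[ μ ] IsAffineDependence ps μ × Nontrivial μ)
¬independent⇒¬¬dependence ps ¬ind ¬dep = ¬ind λ μ Σμ≡0 lμ≡0 → All.lookup⁻ λ j →
  decidable-stable (lookup μ j ≟ 0ℚ) λ μj≢0 → ¬dep (μ , (Σμ≡0 , lμ≡0) , j , μj≢0)

¬independent-map-· : ∀ c (ps : Vec (Vec ℚ N) k) →
                     ¬ AffinelyIndependent ps → ¬ AffinelyIndependent (map (c ·_) ps)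
¬independent-map-· c ps ¬ind ind = ¬ind λ μ Σμ≡0 lμ≡0 →
  ind μ Σμ≡0 (trans (lincomb-map-· c μ ps) (trans (cong (c ·_) lμ≡0) (·-zeroʳ c)))

dependence-combination : ∀ {ps : Vec (Vec ℚ N) k} c d {μ ν} → IsAffineDependence ps μ → IsAffineDependence ps ν →
                         IsAffineDependence ps (c · μ ⊕ d · ν)
dependence-combination {N} {ps = ps} c d {μ} {ν} (Σμ≡0 , lμ≡0) (Σν≡0 , lν≡0) = Σ≡0 , l≡0
  where
  open ≡-Reasoning
  Σ≡0 : sumℚ (c · μ ⊕ d · ν) ≡ 0ℚ
  Σ≡0 = begin
    sumℚ (c · μ ⊕ d · ν)         ≡⟨ sumℚ-⊕ (c · μ) (d · ν) ⟩
    sumℚ (c · μ) + sumℚ (d · ν)  ≡⟨ cong₂ _+_ (sumℚ-· c μ) (sumℚ-· d ν) ⟩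
    c * sumℚ μ + d * sumℚ ν      ≡⟨ cong₂ (λ x y → c * x + d * y) Σμ≡0 Σν≡0 ⟩
    c * 0ℚ + d * 0ℚ              ≡⟨ cong₂ _+_ (*-zeroʳ c) (*-zeroʳ d) ⟩
    0ℚ                           ∎
  l≡0 : lincomb (c · μ ⊕ d · ν) ps ≡ 0ᵛ N
  l≡0 = begin
    lincomb (c · μ ⊕ d · ν) ps               ≡⟨ lincomb-⊕ (c · μ) (d · ν) ps ⟩
    lincomb (c · μ) ps ⊕ lincomb (d · ν) ps  ≡⟨ cong₂ _⊕_ (lincomb-· c μ ps) (lincomb-· d ν ps) ⟩
    c · lincomb μ ps ⊕ d · lincomb ν ps      ≡⟨ cong₂ (λ x y → c · x ⊕ d · y) lμ≡0 lν≡0 ⟩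
    c · 0ᵛ N ⊕ d · 0ᵛ N                      ≡⟨ cong₂ _⊕_ (·-zeroʳ c) (·-zeroʳ d) ⟩
    0ᵛ N ⊕ 0ᵛ N                              ≡⟨ ⊕-identityˡ (0ᵛ N) ⟩
    0ᵛ N                                     ∎

dependence-insertAt-0 : (ps : Vec (Vec ℚ N) (suc n)) (j : Fin (suc n)) {μ : Vec ℚ n} →
                        IsAffineDependence (removeAt ps j) μ → IsAffineDependence ps (insertAt μ j 0ℚ)
dependence-insertAt-0 ps j {μ} (Σμ≡0 , lμ≡0) =
  trans (sumℚ-insertAt-0 μ j) Σμ≡0 , trans (lincomb-insertAt-0 μ ps j) lμ≡0

dependence-zipWith-∷ : ∀ {ps : Vec (Vec ℚ N) k} ζ {κ} → IsAffineDependence ps κ → dot κ ζ ≡ 0ℚ →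
                       IsAffineDependence (zipWith _∷_ ζ ps) κ
dependence-zipWith-∷ {ps = ps} ζ {κ} (Σκ≡0 , lκ≡0) κζ≡0 =
  Σκ≡0 , trans (lincomb-zipWith-∷ κ ζ ps) (cong₂ _∷_ κζ≡0 lκ≡0)

orthogonal-dependence : ∀ {ps : Vec (Vec ℚ N) k} ζ {μ ν j} →
  IsAffineDependence ps μ → lookup μ j ≢ 0ℚ → IsAffineDependence ps ν → Nontrivial ν → lookup ν j ≡ 0ℚ →
  ∃[ κ ] IsAffineDependence ps κ × Nontrivial κ × dot κ ζ ≡ 0ℚ
orthogonal-dependence ζ {μ} {ν} {j} dμ μj≢0 dν ν-nontrivial νj≡0 with dot ν ζ ≟ 0ℚ
... | yes νζ≡0 = ν , dν , ν-nontrivial , νζ≡0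
... | no  νζ≢0 = κ , dependence-combination νζ (- μζ) dμ dν , (j , κj≢0) , κζ≡0
  where
  open ≡-Reasoning
  νζ = dot ν ζ
  μζ = dot μ ζ
  κ = νζ · μ ⊕ (- μζ) · ν
  κζ≡0 : dot κ ζ ≡ 0ℚ
  κζ≡0 = begin
    dot κ ζ                               ≡⟨ dot-⊕ (νζ · μ) ((- μζ) · ν) ζ ⟩
    dot (νζ · μ) ζ + dot ((- μζ) · ν) ζ   ≡⟨ cong₂ _+_ (dot-· νζ μ ζ) (dot-· (- μζ) ν ζ) ⟩
    νζ * μζ + (- μζ) * νζ                 ≡⟨ solve 2 (λ x y → x :* y :+ (:- y) :* x := con 0ℚ) refl νζ μζ ⟩
    0ℚ                                    ∎
  κj≡νζ*μj : lookup κ j ≡ νζ * lookup μ j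
  κj≡νζ*μj = begin
    lookup κ j
      ≡⟨ Vec.lookup-zipWith _+_ j (νζ · μ) ((- μζ) · ν) ⟩
    lookup (νζ · μ) j + lookup ((- μζ) · ν) j
      ≡⟨ cong₂ _+_ (Vec.lookup-map j (νζ *_) μ) (Vec.lookup-map j ((- μζ) *_) ν) ⟩
    νζ * lookup μ j + (- μζ) * lookup ν j
      ≡⟨ cong (λ x → νζ * lookup μ j + (- μζ) * x) νj≡0 ⟩
    νζ * lookup μ j + (- μζ) * 0ℚ
      ≡⟨ solve 3 (λ x y z → x :* y :+ z :* con 0ℚ := x :* y) refl νζ (lookup μ j) (- μζ) ⟩
    νζ * lookup μ j ∎
  κj≢0 : lookup κ j ≢ 0ℚ
  κj≢0 κj≡0 = νζ≢0 (x*y≡0⇒x≡0 μj≢0 (trans (sym κj≡νζ*μj) κj≡0))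

-- Dropping a point leaves a dependence vanishing there, so ps has two
-- non-proportional dependences, and a combination of them also kills ζ.
¬independent-zipWith-∷ : (ζ : Vec ℚ (suc n)) (ps : Vec (Vec ℚ N) (suc n)) →
                         (∀ j → ¬ AffinelyIndependent (removeAt ps j)) →
                         ¬ AffinelyIndependent (zipWith _∷_ ζ ps)
¬independent-zipWith-∷ ζ ps ¬ind ind =
  dependence-vanishing-at zero λ (μ , dμ , (j , μj≢0) , _) →
  dependence-vanishing-at j    λ (ν , dν , ν-nontrivial , νj≡0) →
  let κ , dκ , κ-nontrivial , κζ≡0 = orthogonal-dependence ζ dμ μj≢0 dν ν-nontrivial νj≡0
  in independent⇒trivial ind (dependence-zipWith-∷ ζ dκ κζ≡0) κ-nontrivial
  where
  dependence-vanishing-at : ∀ j →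
    ¬ ¬ (∃[ μ ] IsAffineDependence ps μ × Nontrivial μ × lookup μ j ≡ 0ℚ)
  dependence-vanishing-at j ¬dep = ¬independent⇒¬¬dependence (removeAt ps j) (¬ind j)
    λ (μ , dμ , (i , μi≢0)) → ¬dep (insertAt μ j 0ℚ , dependence-insertAt-0 ps j dμ ,
      (Fin.punchIn j i , subst (_≢ 0ℚ) (sym (Vec.insertAt-punchIn μ j 0ℚ i)) μi≢0) ,
      Vec.insertAt-lookup μ j 0ℚ)

-- The prism and its dimension

lift : ℕ → ℤ → Vec ℤ N → Vec ℤ (suc N)
lift a z v = z ∷ map (+ a ℤ.*_) v

-- conv (prism a b V) = [0, b] × a·conv V.
prism : ℕ → ℕ → Vec (Vec ℤ N) k → Vec (Vec ℤ (suc N)) (k ℕ.+ k)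
prism a b V = map (lift a (+ 0)) V ++ map (lift a (+ b)) V

toℚv-lift : ∀ a z (v : Vec ℤ N) → toℚv (lift a z v) ≡ ℤ→ℚ z ∷ ℕ→ℚ a · toℚv v
toℚv-lift a z v = cong (ℤ→ℚ z ∷_) (begin
  map ℤ→ℚ (map (+ a ℤ.*_) v)        ≡⟨ sym (Vec.map-∘ ℤ→ℚ (+ a ℤ.*_) v) ⟩
  map (ℤ→ℚ ∘ (+ a ℤ.*_)) v          ≡⟨ Vec.map-cong (ℤ→ℚ-* (+ a)) v ⟩
  map ((ℕ→ℚ a *_) ∘ ℤ→ℚ) v          ≡⟨ Vec.map-∘ (ℕ→ℚ a *_) ℤ→ℚ v ⟩
  ℕ→ℚ a · toℚv v                    ∎)
  where open ≡-Reasoning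

map-toℚv-zipWith-lift : ∀ a (zs : Vec ℤ k) (S : Vec (Vec ℤ N) k) →
  map toℚv (zipWith (lift a) zs S) ≡ zipWith _∷_ (map ℤ→ℚ zs) (map (ℕ→ℚ a ·_) (map toℚv S))
map-toℚv-zipWith-lift a []       []      = refl
map-toℚv-zipWith-lift a (z ∷ zs) (v ∷ S) = cong₂ _∷_ (toℚv-lift a z v) (map-toℚv-zipWith-lift a zs S)

lincomb-map-lift : ∀ a z (μ : Vec ℚ k) (S : Vec (Vec ℤ N) k) →
  lincomb μ (map toℚv (map (lift a z) S)) ≡ (ℤ→ℚ z * sumℚ μ) ∷ ℕ→ℚ a · lincomb μ (map toℚv S)
lincomb-map-lift {k} a z μ S = begin
  lincomb μ (map toℚv (map (lift a z) S))
    ≡⟨ cong (lincomb μ ∘ map toℚv) (sym (Vec.zipWith-replicate₁ (lift a) z S)) ⟩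
  lincomb μ (map toℚv (zipWith (lift a) (replicate k z) S))
    ≡⟨ cong (lincomb μ) (map-toℚv-zipWith-lift a (replicate k z) S) ⟩
  lincomb μ (zipWith _∷_ (map ℤ→ℚ (replicate k z)) (map (ℕ→ℚ a ·_) (map toℚv S)))
    ≡⟨ lincomb-zipWith-∷ μ _ _ ⟩
  dot μ (map ℤ→ℚ (replicate k z)) ∷ lincomb μ (map (ℕ→ℚ a ·_) (map toℚv S))
    ≡⟨ cong₂ _∷_ (trans (cong (dot μ) (Vec.map-replicate ℤ→ℚ z k)) (dot-replicate μ (ℤ→ℚ z)))
                 (lincomb-map-· (ℕ→ℚ a) μ (map toℚv S)) ⟩
  (ℤ→ℚ z * sumℚ μ) ∷ ℕ→ℚ a · lincomb μ (map toℚv S)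
    ∎
  where open ≡-Reasoning

∈-prism⁻ : ∀ a b (V : Vec (Vec ℤ N) k) {x} → x ∈ᵥ prism a b V → ∃[ z ] ∃[ v ] v ∈ᵥ V × x ≡ lift a z v
∈-prism⁻ a b V x∈ with Any.++⁻ (map (lift a (+ 0)) V) x∈
... | inj₁ x∈bottom = let v , v∈V , x≡ = find (Any.map⁻ x∈bottom) in + 0 , v , v∈V , x≡
... | inj₂ x∈top    = let v , v∈V , x≡ = find (Any.map⁻ x∈top)    in + b , v , v∈V , x≡

All-∈-prism⁻ : ∀ a b (V : Vec (Vec ℤ N) k) {T : Vec (Vec ℤ (suc N)) n} → All (_∈ᵥ prism a b V) T →
  ∃[ zs ] ∃[ S ] All (_∈ᵥ V) S × T ≡ zipWith (lift a) zs S
All-∈-prism⁻ a b V []             = [] , [] , [] , refl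
All-∈-prism⁻ a b V (x∈ ∷ T⊆prism) with ∈-prism⁻ a b V x∈ | All-∈-prism⁻ a b V T⊆prism
... | z , v , v∈V , x≡ | zs , S , S⊆V , T≡ = z ∷ zs , v ∷ S , v∈V ∷ S⊆V , cong₂ _∷_ x≡ T≡

removeAt-map : ∀ {A B : Set} (f : A → B) (xs : Vec A (suc n)) j → removeAt (map f xs) j ≡ map f (removeAt xs j)
removeAt-map f (x ∷ xs)          zero    = refl
removeAt-map f (x ∷ xs@(_ ∷ _)) (suc j) = cong (f x ∷_) (removeAt-map f xs j)

All-removeAt : ∀ {A : Set} {P : A → Set} {xs : Vec A (suc n)} j → All P xs → All P (removeAt xs j)
All-removeAt                     zero    (px ∷ pxs) = pxs
All-removeAt {xs = _ ∷ _ ∷ _} (suc j) (px ∷ pxs) = px ∷ All-removeAt j pxs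

independent-prism-simplex : ∀ a b (p : Vec ℤ N) (S : Vec (Vec ℤ N) k) → AffinelyIndependent (map toℚv S) →
  AffinelyIndependent (map toℚv (lift (suc a) (+ suc b) p ∷ map (lift (suc a) (+ 0)) S))
independent-prism-simplex {N} a b p S indS (μ₀ ∷ μ) Σ≡0 l≡0 = μ₀≡0 ∷ indS μ Σμ≡0 lμ≡0
  where
  A = ℕ→ℚ (suc a)
  B = ℕ→ℚ (suc b)
  l≡0′ : μ₀ · (B ∷ A · toℚv p) ⊕ ((0ℚ * sumℚ μ) ∷ A · lincomb μ (map toℚv S)) ≡ 0ℚ ∷ 0ᵛ N
  l≡0′ = trans (sym (cong₂ (λ x y → μ₀ · x ⊕ y) (toℚv-lift (suc a) (+ suc b) p)
                                                 (lincomb-map-lift (suc a) (+ 0) μ S)))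
               l≡0
  μ₀≡0 : μ₀ ≡ 0ℚ
  μ₀≡0 = x*y≡0⇒x≡0 (ℕ→ℚ-suc≢0 b) (trans
    (solve 3 (λ x y z → x :* y := x :* y :+ con 0ℚ :* z) refl μ₀ B (sumℚ μ)) (Vec.∷-injectiveˡ l≡0′))
  Σμ≡0 : sumℚ μ ≡ 0ℚ
  Σμ≡0 = trans (sym (+-identityˡ (sumℚ μ))) (trans (cong (_+ sumℚ μ) (sym μ₀≡0)) Σ≡0)
  lμ≡0 : lincomb μ (map toℚv S) ≡ 0ᵛ N
  lμ≡0 = ·-cancel _ (ℕ→ℚ-suc≢0 a) (begin
    A · lincomb μ (map toℚv S)
      ≡⟨ sym (⊕-identityˡ _) ⟩
    0ᵛ N ⊕ A · lincomb μ (map toℚv S)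
      ≡⟨ cong (_⊕ A · lincomb μ (map toℚv S)) (sym (·-zeroˡ (A · toℚv p))) ⟩
    0ℚ · A · toℚv p ⊕ A · lincomb μ (map toℚv S)
      ≡⟨ cong (λ x → x · A · toℚv p ⊕ A · lincomb μ (map toℚv S)) (sym μ₀≡0) ⟩
    μ₀ · A · toℚv p ⊕ A · lincomb μ (map toℚv S)
      ≡⟨ Vec.∷-injectiveʳ l≡0′ ⟩
    0ᵛ N ∎)
    where open ≡-Reasoning

¬independent-prism : ∀ {m} a b (V : Vec (Vec ℤ N) k) →
  (∀ (S : Vec (Vec ℤ N) (suc m)) → All (_∈ᵥ V) S → ¬ AffinelyIndependent (map toℚv S)) →
  ∀ (T : Vec (Vec ℤ (suc N)) (suc (suc m))) → All (_∈ᵥ prism a b V) T → ¬ AffinelyIndependent (map toℚv T)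
¬independent-prism a b V ¬indV T T⊆prism with All-∈-prism⁻ a b V T⊆prism
... | zs , S , S⊆V , refl =
  subst (¬_ ∘ AffinelyIndependent) (sym (map-toℚv-zipWith-lift a zs S))
    (¬independent-zipWith-∷ (map ℤ→ℚ zs) (map (A ·_) (map toℚv S)) λ j →
      subst (¬_ ∘ AffinelyIndependent)
        (sym (trans (removeAt-map (A ·_) (map toℚv S) j) (cong (map (A ·_)) (removeAt-map toℚv S j))))
        (¬independent-map-· A _ (¬indV (removeAt S j) (All-removeAt j S⊆V))))
  where A = ℕ→ℚ a

hasDim-prism : ∀ {d} a b (V : Vec (Vec ℤ N) k) → HasDim V d → HasDim (prism (suc a) (suc b) V) (suc d)
hasDim-prism a b V ((p ∷ S , p∈V ∷ S⊆V , indS) , ¬indV) =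
  (lift (suc a) (+ suc b) p ∷ map (lift (suc a) (+ 0)) (p ∷ S) , top∈ ∷ bottom⊆ ,
   independent-prism-simplex a b p (p ∷ S) indS) ,
  ¬independent-prism (suc a) (suc b) V ¬indV
  where
  top∈ = ∈-++⁺ʳ (map (lift (suc a) (+ 0)) V) (∈-map⁺ (lift (suc a) (+ suc b)) p∈V)
  bottom⊆ = All.map⁺ (All.map (∈-++⁺ˡ ∘ ∈-map⁺ (lift (suc a) (+ 0))) (p∈V ∷ S⊆V))

-- Lattice points of the prism

lincomb-prism : ∀ a b (V : Vec (Vec ℤ N) k) (l₀ l₁ : Vec ℚ k) →
  lincomb (l₀ ++ l₁) (map toℚv (prism a b V)) ≡ (ℕ→ℚ b * sumℚ l₁) ∷ ℕ→ℚ a · lincomb (l₀ ⊕ l₁) (map toℚv V)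
lincomb-prism a b V l₀ l₁ = begin
  lincomb (l₀ ++ l₁) (map toℚv (map (lift a (+ 0)) V ++ map (lift a (+ b)) V))
    ≡⟨ cong (lincomb (l₀ ++ l₁)) (Vec.map-++ toℚv (map (lift a (+ 0)) V) _) ⟩
  lincomb (l₀ ++ l₁) (map toℚv (map (lift a (+ 0)) V) ++ map toℚv (map (lift a (+ b)) V))
    ≡⟨ lincomb-++ l₀ l₁ _ _ ⟩
  lincomb l₀ (map toℚv (map (lift a (+ 0)) V)) ⊕ lincomb l₁ (map toℚv (map (lift a (+ b)) V))
    ≡⟨ cong₂ _⊕_ (lincomb-map-lift a (+ 0) l₀ V) (lincomb-map-lift a (+ b) l₁ V) ⟩
  (0ℚ * sumℚ l₀ + B * sumℚ l₁) ∷ (A · lincomb l₀ Vℚ ⊕ A · lincomb l₁ Vℚ)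
    ≡⟨ cong₂ _∷_ (solve 3 (λ x y B → con 0ℚ :* x :+ B :* y := B :* y) refl (sumℚ l₀) (sumℚ l₁) B)
                 (trans (sym (·-distribˡ-⊕ A _ _)) (cong (A ·_) (sym (lincomb-⊕ l₀ l₁ Vℚ)))) ⟩
  (B * sumℚ l₁) ∷ A · lincomb (l₀ ⊕ l₁) Vℚ
    ∎
  where
  open ≡-Reasoning
  A = ℕ→ℚ a
  B = ℕ→ℚ b
  Vℚ = map toℚv V

∈-dilate-prism⁻ : ∀ a b (V : Vec (Vec ℤ N) k) t x₀ y → InDilate (prism (suc a) (suc b) V) t (x₀ ∷ y) →
  InDilate V (t ℕ.* suc a) y × ∃[ h ] x₀ ≡ + h × h ≤ t ℕ.* suc b
∈-dilate-prism⁻ {k = k} a b V t x₀ y (λ′ , 0≤λ′ , Σλ′≡t , lλ′≡x) with Vec.splitAt k λ′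
... | l₀ , l₁ , refl = (A · (l₀ ⊕ l₁) , 0≤μ , Σμ≡ta , lμ≡y) , height
  where
  open ≡-Reasoning
  A = ℕ→ℚ (suc a)
  B = ℕ→ℚ (suc b)
  T = ℕ→ℚ t
  Vℚ = map toℚv V
  0≤l₀ = proj₁ (All.++⁻ l₀ 0≤λ′)
  0≤l₁ = proj₂ (All.++⁻ l₀ 0≤λ′)
  lλ′≡x′ = trans (sym (lincomb-prism (suc a) (suc b) V l₀ l₁)) lλ′≡x
  Σl₀+Σl₁≡T : sumℚ l₀ + sumℚ l₁ ≡ T
  Σl₀+Σl₁≡T = trans (sym (sumℚ-++ l₀ l₁)) Σλ′≡t
  0≤μ = All-nonNeg-· (ℕ→ℚ-nonNeg (suc a)) (All-nonNeg-⊕ 0≤l₀ 0≤l₁)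
  Σμ≡ta : sumℚ (A · (l₀ ⊕ l₁)) ≡ ℕ→ℚ (t ℕ.* suc a)
  Σμ≡ta = begin
    sumℚ (A · (l₀ ⊕ l₁))    ≡⟨ sumℚ-· A (l₀ ⊕ l₁) ⟩
    A * sumℚ (l₀ ⊕ l₁)      ≡⟨ cong (A *_) (trans (sumℚ-⊕ l₀ l₁) Σl₀+Σl₁≡T) ⟩
    A * T                   ≡⟨ *-comm A T ⟩
    T * A                   ≡⟨ sym (ℕ→ℚ-* t (suc a)) ⟩
    ℕ→ℚ (t ℕ.* suc a)       ∎
  lμ≡y : lincomb (A · (l₀ ⊕ l₁)) Vℚ ≡ toℚv y
  lμ≡y = trans (lincomb-· A (l₀ ⊕ l₁) Vℚ) (Vec.∷-injectiveʳ lλ′≡x′)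
  x₀≡BΣl₁ : ℤ→ℚ x₀ ≡ B * sumℚ l₁
  x₀≡BΣl₁ = sym (Vec.∷-injectiveˡ lλ′≡x′)
  Σl₁≤T : sumℚ l₁ ℚ.≤ T
  Σl₁≤T = subst₂ ℚ._≤_ (+-identityˡ (sumℚ l₁)) Σl₀+Σl₁≡T (+-monoˡ-≤ (sumℚ l₁) (sumℚ-nonNeg 0≤l₀))
  0≤x₀ : + 0 ℤ.≤ x₀
  0≤x₀ = ℤ→ℚ-cancel-≤ {+ 0} {x₀}
    (subst (0ℚ ℚ.≤_) (sym x₀≡BΣl₁) (nonNeg-* (ℕ→ℚ-nonNeg (suc b)) (sumℚ-nonNeg 0≤l₁)))
  x₀≤tb : x₀ ℤ.≤ + (t ℕ.* suc b)
  x₀≤tb = ℤ→ℚ-cancel-≤ {x₀} {+ (t ℕ.* suc b)} (subst₂ ℚ._≤_ (sym x₀≡BΣl₁)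
    (trans (*-comm B T) (sym (ℕ→ℚ-* t (suc b))))
    (*-monoˡ-≤-nonNeg B {{nonNegative (ℕ→ℚ-nonNeg (suc b))}} Σl₁≤T))
  +∣x₀∣≡x₀ = ℤ.0≤i⇒+∣i∣≡i 0≤x₀
  height : ∃[ h ] x₀ ≡ + h × h ≤ t ℕ.* suc b
  height = ℤ.∣ x₀ ∣ , sym +∣x₀∣≡x₀ , ℤ.drop‿+≤+ (subst (ℤ._≤ + (t ℕ.* suc b)) (sym +∣x₀∣≡x₀) x₀≤tb)

lincomb-prism-· : ∀ a b (V : Vec (Vec ℤ N) k) (u₀ u₁ : ℚ) (μ : Vec ℚ k) →
  lincomb (u₀ · μ ++ u₁ · μ) (map toℚv (prism a b V)) ≡
    (ℕ→ℚ b * (u₁ * sumℚ μ)) ∷ (ℕ→ℚ a * (u₀ + u₁)) · lincomb μ (map toℚv V)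
lincomb-prism-· a b V u₀ u₁ μ = begin
  lincomb (u₀ · μ ++ u₁ · μ) (map toℚv (prism a b V))
    ≡⟨ lincomb-prism a b V (u₀ · μ) (u₁ · μ) ⟩
  (B * sumℚ (u₁ · μ)) ∷ A · lincomb (u₀ · μ ⊕ u₁ · μ) Vℚ
    ≡⟨ cong₂ (λ x l → (B * x) ∷ A · lincomb l Vℚ) (sumℚ-· u₁ μ) (sym (·-distribʳ-+ u₀ u₁ μ)) ⟩
  (B * (u₁ * sumℚ μ)) ∷ A · lincomb ((u₀ + u₁) · μ) Vℚ
    ≡⟨ cong ((B * (u₁ * sumℚ μ)) ∷_)
            (trans (cong (A ·_) (lincomb-· (u₀ + u₁) μ Vℚ)) (·-assoc A (u₀ + u₁) _)) ⟩
  (B * (u₁ * sumℚ μ)) ∷ (A * (u₀ + u₁)) · lincomb μ Vℚ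
    ∎
  where
  open ≡-Reasoning
  A = ℕ→ℚ a
  B = ℕ→ℚ b
  Vℚ = map toℚv V

sumℚ-·-++-· : ∀ (u₀ u₁ : ℚ) (μ : Vec ℚ k) → sumℚ (u₀ · μ ++ u₁ · μ) ≡ (u₀ + u₁) * sumℚ μ
sumℚ-·-++-· u₀ u₁ μ = trans (sumℚ-++ (u₀ · μ) (u₁ · μ))
  (trans (cong₂ _+_ (sumℚ-· u₀ μ) (sumℚ-· u₁ μ)) (sym (*-distribʳ-+ (sumℚ μ) u₀ u₁)))

-- A point (h, y) of the dilate is spread over the two floors with weights
-- in the ratio (tb - h) : h.
∈-dilate-prism⁺ : ∀ a b (V : Vec (Vec ℤ N) k) t h y → h ≤ suc t ℕ.* suc b →
  InDilate V (suc t ℕ.* suc a) y → InDilate (prism (suc a) (suc b) V) (suc t) (+ h ∷ y)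
∈-dilate-prism⁺ a b V t h y h≤tb (μ , 0≤μ , Σμ≡ta , lμ≡y) = u₀ · μ ++ u₁ · μ , 0≤λ , Σλ≡t , lλ≡x
  where
  A = ℕ→ℚ (suc a)
  B = ℕ→ℚ (suc b)
  T = ℕ→ℚ (suc t)
  D = A * T * B
  instance
    D-positive : Positive D
    D-positive = pos*pos⇒pos (A * T) {{pos*pos⇒pos A {{positive (ℕ→ℚ-pos a)}} T {{positive (ℕ→ℚ-pos t)}}}}
                             B {{positive (ℕ→ℚ-pos b)}}
    D-nonZero : NonZero D
    D-nonZero = pos⇒nonZero D
  α = 1/ D
  W = ℕ→ℚ (suc t ℕ.* suc b ∸ h)
  Z = ℕ→ℚ h
  u₀ = W * α
  u₁ = Z * α
  0≤α : 0ℚ ℚ.≤ α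
  0≤α = <⇒≤ (positive⁻¹ α {{1/pos⇒pos D}})
  0≤λ : All (0ℚ ℚ.≤_) (u₀ · μ ++ u₁ · μ)
  0≤λ = All.++⁺ (All-nonNeg-· (nonNeg-* (ℕ→ℚ-nonNeg (suc t ℕ.* suc b ∸ h)) 0≤α) 0≤μ)
                (All-nonNeg-· (nonNeg-* (ℕ→ℚ-nonNeg h) 0≤α) 0≤μ)
  Σμ≡TA : sumℚ μ ≡ T * A
  Σμ≡TA = trans Σμ≡ta (ℕ→ℚ-* (suc t) (suc a))
  u₀+u₁≡TBα : u₀ + u₁ ≡ T * B * α
  u₀+u₁≡TBα = trans (sym (*-distribʳ-+ α W Z)) (cong (_* α) (begin
    W + Z                                  ≡⟨ sym (ℕ→ℚ-+ (suc t ℕ.* suc b ∸ h) h) ⟩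
    ℕ→ℚ (suc t ℕ.* suc b ∸ h ℕ.+ h)        ≡⟨ cong ℕ→ℚ (ℕ.m∸n+n≡m h≤tb) ⟩
    ℕ→ℚ (suc t ℕ.* suc b)                  ≡⟨ ℕ→ℚ-* (suc t) (suc b) ⟩
    T * B                                  ∎))
    where open ≡-Reasoning
  x*Dα≡x : ∀ x → x * (D * α) ≡ x
  x*Dα≡x x = trans (cong (x *_) (*-inverseʳ D)) (*-identityʳ x)
  Σλ≡t : sumℚ (u₀ · μ ++ u₁ · μ) ≡ T
  Σλ≡t = trans (sumℚ-·-++-· u₀ u₁ μ) (trans (cong₂ _*_ u₀+u₁≡TBα Σμ≡TA)
    (trans (solve 4 (λ A T B α → T :* B :* α :* (T :* A) := T :* (A :* T :* B :* α)) refl A T B α) (x*Dα≡x T)))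
  BΣl₁≡Z : B * (u₁ * sumℚ μ) ≡ Z
  BΣl₁≡Z = trans (cong (λ σ → B * (u₁ * σ)) Σμ≡TA)
    (trans (solve 5 (λ A T B α Z → B :* (Z :* α :* (T :* A)) := Z :* (A :* T :* B :* α)) refl A T B α Z) (x*Dα≡x Z))
  A[u₀+u₁]≡1 : A * (u₀ + u₁) ≡ 1ℚ
  A[u₀+u₁]≡1 = trans (cong (A *_) u₀+u₁≡TBα)
    (trans (solve 4 (λ A T B α → A :* (T :* B :* α) := con 1ℚ :* (A :* T :* B :* α)) refl A T B α) (x*Dα≡x 1ℚ))
  lλ≡x : lincomb (u₀ · μ ++ u₁ · μ) (map toℚv (prism (suc a) (suc b) V)) ≡ toℚv (+ h ∷ y)
  lλ≡x = trans (lincomb-prism-· (suc a) (suc b) V u₀ u₁ μ)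
    (cong₂ _∷_ BΣl₁≡Z (trans (cong₂ _·_ A[u₀+u₁]≡1 lμ≡y) (·-identityˡ (toℚv y))))

length-cartesianProductWith : ∀ {A B C : Set} (f : A → B → C) (xs : List A) (ys : List B) →
  length (cartesianProductWith f xs ys) ≡ length xs ℕ.* length ys
length-cartesianProductWith f List.[]         ys = refl
length-cartesianProductWith f (x List.∷ xs) ys = begin
  length (List.map (f x) ys List.++ cartesianProductWith f xs ys)
    ≡⟨ List.length-++ (List.map (f x) ys) ⟩
  length (List.map (f x) ys) ℕ.+ length (cartesianProductWith f xs ys)
    ≡⟨ cong₂ ℕ._+_ (List.length-map (f x) ys) (length-cartesianProductWith f xs ys) ⟩
  length ys ℕ.+ length xs ℕ.* length ys ∎
  where open ≡-Reasoning

latticeCount-prism : ∀ a b (V : Vec (Vec ℤ N) k) t n → LatticeCount V (suc t ℕ.* suc a) n →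
  LatticeCount (prism (suc a) (suc b) V) (suc t) (suc (suc t ℕ.* suc b) ℕ.* n)
latticeCount-prism {N} a b V t n (L , unique , sound , complete , length≡n) =
  L′ , unique′ , ListAll.tabulate sound′ , complete′ , length≡
  where
  tb = suc t ℕ.* suc b
  point : ℕ → Vec ℤ N → Vec ℤ (suc N)
  point h y = + h ∷ y
  point-injective : ∀ {h h′ y y′} → point h y ≡ point h′ y′ → h ≡ h′ × y ≡ y′
  point-injective refl = refl , refl
  L′ = cartesianProductWith point (upTo (suc tb)) L
  unique′ = Unique.cartesianProductWith⁺ point point-injective (Unique.upTo⁺ (suc tb)) unique
  sound′ : ∀ {x} → x ∈ L′ → InDilate (prism (suc a) (suc b) V) (suc t) x
  sound′ x∈L′ with ∈-cartesianProductWith⁻ point (upTo (suc tb)) L x∈L′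
  ... | h , y , h∈ , y∈L , refl =
    ∈-dilate-prism⁺ a b V t h y (ℕ.≤-pred (∈-upTo⁻ h∈)) (ListAll.lookup sound y∈L)
  complete′ : ∀ x → InDilate (prism (suc a) (suc b) V) (suc t) x → x ∈ L′
  complete′ (x₀ ∷ y) x∈ with ∈-dilate-prism⁻ a b V (suc t) x₀ y x∈
  ... | y∈ , h , refl , h≤tb = ∈-cartesianProductWith⁺ point (∈-upTo⁺ (s≤s h≤tb)) (complete y y∈)
  length≡ : length L′ ≡ suc tb ℕ.* n
  length≡ = trans (length-cartesianProductWith point (upTo (suc tb)) L)
                  (cong₂ ℕ._*_ (List.length-upTo (suc tb)) length≡n)

-- Ehrhart polynomial of the prism

eval : (ℕ → ℚ) → ℕ → ℚ → ℚ
eval e zero    x = e 0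
eval e (suc n) x = eval e n x + e (suc n) * x ^ℚ suc n

ehrPoly≡eval : ∀ {c e : ℕ → ℚ} n → e 0 ≡ 1ℚ → (∀ i → 1 ≤ i → i ≤ n → e i ≡ c i) →
               ∀ x → ehrPoly c n x ≡ eval e n x
ehrPoly≡eval zero    e₀≡1 e≗c x = sym e₀≡1
ehrPoly≡eval (suc n) e₀≡1 e≗c x = cong₂ (λ u v → u + v * x ^ℚ suc n)
  (ehrPoly≡eval n e₀≡1 (λ i 1≤i i≤n → e≗c i 1≤i (ℕ.m≤n⇒m≤1+n i≤n)) x)
  (sym (e≗c (suc n) (s≤s z≤n) ℕ.≤-refl))

^ℚ-distribˡ-* : ∀ x y n → (x * y) ^ℚ n ≡ x ^ℚ n * y ^ℚ n
^ℚ-distribˡ-* x y zero    = refl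
^ℚ-distribˡ-* x y (suc n) = trans (cong (x * y *_) (^ℚ-distribˡ-* x y n))
  (solve 4 (λ x y p q → x :* y :* (p :* q) := x :* p :* (y :* q)) refl x y (x ^ℚ n) (y ^ℚ n))

1^n≡1 : ∀ n → 1ℚ ^ℚ n ≡ 1ℚ
1^n≡1 zero    = refl
1^n≡1 (suc n) = trans (cong (1ℚ *_) (1^n≡1 n)) (*-identityˡ 1ℚ)

-- Coefficients of p(A x) and of (1 + B x) p(x), for p(x) = Σᵢ eᵢ xⁱ.
dilate : ℚ → (ℕ → ℚ) → ℕ → ℚ
dilate A e i = e i * A ^ℚ i

shift : (ℕ → ℚ) → ℕ → ℚ
shift e zero    = 0ℚ
shift e (suc i) = e i

times1+ : ℚ → (ℕ → ℚ) → ℕ → ℚ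
times1+ B e i = e i + B * shift e i

eval-dilate : ∀ A e n x → eval (dilate A e) n x ≡ eval e n (x * A)
eval-dilate A e zero    x = *-identityʳ (e 0)
eval-dilate A e (suc n) x = cong₂ _+_ (eval-dilate A e n x) (begin
  e (suc n) * A ^ℚ suc n * x ^ℚ suc n
    ≡⟨ solve 3 (λ e a p → e :* a :* p := e :* (p :* a)) refl (e (suc n)) (A ^ℚ suc n) (x ^ℚ suc n) ⟩
  e (suc n) * (x ^ℚ suc n * A ^ℚ suc n)
    ≡⟨ cong (e (suc n) *_) (sym (^ℚ-distribˡ-* x A (suc n))) ⟩
  e (suc n) * (x * A) ^ℚ suc n ∎)
  where open ≡-Reasoning

eval-times1+ : ∀ B e n x → eval (times1+ B e) (suc n) x ≡ eval e (suc n) x + x * B * eval e n x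
eval-times1+ B e zero    x = solve 4
  (λ e₀ e₁ B x → (e₀ :+ B :* con 0ℚ) :+ (e₁ :+ B :* e₀) :* (x :* con 1ℚ)
              := (e₀ :+ e₁ :* (x :* con 1ℚ)) :+ x :* B :* e₀)
  refl (e 0) (e 1) B x
eval-times1+ B e (suc n) x =
  trans (cong (_+ times1+ B e (suc (suc n)) * x ^ℚ suc (suc n)) (eval-times1+ B e n x))
  (solve 7 (λ E₁ E₀ e₂ e₁ B x p → (E₁ :+ x :* B :* E₀) :+ (e₂ :+ B :* e₁) :* (x :* p)
                                  := (E₁ :+ e₂ :* (x :* p)) :+ x :* B :* (E₀ :+ e₁ :* p))
     refl (eval e (suc n) x) (eval e n x) (e (suc (suc n))) (e (suc n)) B x (x ^ℚ suc n))

coeffSeq : ℕ → (ℕ → ℚ) → ℕ → ℚ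
coeffSeq d c zero = 1ℚ
coeffSeq d c (suc i) with suc i ℕ.≤? d
... | yes _ = c (suc i)
... | no  _ = 0ℚ

coeffSeq-≤ : ∀ d c i → 1 ≤ i → i ≤ d → coeffSeq d c i ≡ c i
coeffSeq-≤ d c (suc i) _ i≤d with suc i ℕ.≤? d
... | yes _   = refl
... | no  i≰d = contradiction i≤d i≰d

coeffSeq-suc : ∀ d c → coeffSeq d c (suc d) ≡ 0ℚ
coeffSeq-suc d c with suc d ℕ.≤? d
... | yes d<d = contradiction d<d (ℕ.<-irrefl refl)
... | no  _   = refl

prismCoeffs : ℕ → ℕ → ℕ → (ℕ → ℚ) → ℕ → ℚ
prismCoeffs a b d c = times1+ (ℕ→ℚ b) (dilate (ℕ→ℚ a) (coeffSeq d c))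

ehrPoly-prismCoeffs : ∀ a b d c x →
  ehrPoly (prismCoeffs a b d c) (suc d) x ≡ (1ℚ + x * ℕ→ℚ b) * ehrPoly c d (x * ℕ→ℚ a)
ehrPoly-prismCoeffs a b d c x = begin
  ehrPoly (prismCoeffs a b d c) (suc d) x
    ≡⟨ ehrPoly≡eval (suc d) h₀≡1 (λ _ _ _ → refl) x ⟩
  eval (times1+ B f) (suc d) x
    ≡⟨ eval-times1+ B f d x ⟩
  eval f (suc d) x + x * B * eval f d x
    ≡⟨ cong (λ u → eval f d x + u * x ^ℚ suc d + x * B * eval f d x) f-suc-d≡0 ⟩
  eval f d x + 0ℚ * x ^ℚ suc d + x * B * eval f d x
    ≡⟨ solve 4 (λ E p x B → E :+ con 0ℚ :* p :+ x :* B :* E := (con 1ℚ :+ x :* B) :* E)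
               refl (eval f d x) (x ^ℚ suc d) x B ⟩
  (1ℚ + x * B) * eval f d x
    ≡⟨ cong ((1ℚ + x * B) *_) (eval-dilate A e d x) ⟩
  (1ℚ + x * B) * eval e d (x * A)
    ≡⟨ cong ((1ℚ + x * B) *_) (sym (ehrPoly≡eval d refl (coeffSeq-≤ d c) (x * A))) ⟩
  (1ℚ + x * B) * ehrPoly c d (x * A) ∎
  where
  open ≡-Reasoning
  A = ℕ→ℚ a
  B = ℕ→ℚ b
  e = coeffSeq d c
  f = dilate A e
  h₀≡1 : prismCoeffs a b d c 0 ≡ 1ℚ
  h₀≡1 = trans (cong (_+_ (1ℚ * 1ℚ)) (*-zeroʳ B)) refl
  f-suc-d≡0 : f (suc d) ≡ 0ℚ
  f-suc-d≡0 = trans (cong (_* A ^ℚ suc d) (coeffSeq-suc d c)) (*-zeroˡ (A ^ℚ suc d))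

hasEhrhart-prism : ∀ a b (V : Vec (Vec ℤ N) k) d c → HasEhrhart V d c →
  HasEhrhart (prism (suc a) (suc b) V) (suc d) (prismCoeffs (suc a) (suc b) d c)
hasEhrhart-prism a b V d c ehrV (suc t) _ with ehrV (suc t ℕ.* suc a) (s≤s z≤n)
... | n , count , n≡ = suc (suc t ℕ.* suc b) ℕ.* n , latticeCount-prism a b V t n count , (begin
  ℕ→ℚ (suc (suc t ℕ.* suc b) ℕ.* n)
    ≡⟨ ℕ→ℚ-* (suc (suc t ℕ.* suc b)) n ⟩
  ℕ→ℚ (1 ℕ.+ suc t ℕ.* suc b) * ℕ→ℚ n
    ≡⟨ cong₂ _*_ (trans (ℕ→ℚ-+ 1 (suc t ℕ.* suc b)) (cong (_+_ 1ℚ) (ℕ→ℚ-* (suc t) (suc b))))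
                 n≡ ⟩
  (1ℚ + T * B) * ehrPoly c d (ℕ→ℚ (suc t ℕ.* suc a))
    ≡⟨ cong (λ u → (1ℚ + T * B) * ehrPoly c d u) (ℕ→ℚ-* (suc t) (suc a)) ⟩
  (1ℚ + T * B) * ehrPoly c d (T * ℕ→ℚ (suc a))
    ≡⟨ sym (ehrPoly-prismCoeffs (suc a) (suc b) d c T) ⟩
  ehrPoly (prismCoeffs (suc a) (suc b) d c) (suc d) T ∎)
  where
  open ≡-Reasoning
  T = ℕ→ℚ (suc t)
  B = ℕ→ℚ (suc b)

-- Signs

sgn-pos : ∀ {q} → 0ℚ ℚ.< q → sgn q ≡ + 1
sgn-pos {mkℚ +[1+ n ] _ _} _        = refl
sgn-pos {mkℚ (+ 0)    _ _} (*<* 0<0) = contradiction 0<0 (ℤ.<-irrefl refl)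
sgn-pos {mkℚ -[1+ n ] _ _} (*<* ())

sgn-neg : ∀ {q} → q ℚ.< 0ℚ → sgn q ≡ ℤ.- + 1
sgn-neg {mkℚ -[1+ n ] _ _} _                  = refl
sgn-neg {mkℚ (+ 0)    _ _} (*<* 0<0)          = contradiction 0<0 (ℤ.<-irrefl refl)
sgn-neg {mkℚ +[1+ n ] _ _} (*<* (ℤ.+<+ ()))

sgn-*-pos : ∀ {p} q → 0ℚ ℚ.< p → sgn (p * q) ≡ sgn q
sgn-*-pos {p} q 0<p with <-cmp q 0ℚ
... | tri< q<0 _ _ = trans
  (sgn-neg (negative⁻¹ (p * q) {{pos*neg⇒neg p {{positive 0<p}} q {{negative q<0}}}}))
  (sym (sgn-neg q<0))
... | tri≈ _ refl _ = cong sgn (*-zeroʳ p)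
... | tri> _ _ 0<q = trans
  (sgn-pos (positive⁻¹ (p * q) {{pos*pos⇒pos p {{positive 0<p}} q {{positive 0<q}}}}))
  (sym (sgn-pos 0<q))

↧*q≡↥ : ∀ q → ℕ→ℚ (↧ₙ q) * q ≡ ℤ→ℚ (↥ q)
↧*q≡↥ q@(mkℚ n d _) = trans (cong (_* q) (ℤ→ℚ≡mkℚ (+ suc d)))
  (trans (toℚᵘ-injective (ℚᵘ.≃-trans (toℚᵘ-homo-* suc-d q) (ℚᵘ.*≡* cross))) (sym (ℤ→ℚ≡mkℚ n)))
  where
  suc-d = mkℚ (+ suc d) 0 (coprime-sym (1-coprimeTo (suc d)))
  cross : (+ suc d ℤ.* n) ℤ.* + 1 ≡ n ℤ.* + (suc d ℕ.+ 0)
  cross = trans (ℤ.*-identityʳ _)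
    (trans (ℤ.*-comm (+ suc d) n) (cong (λ m → n ℤ.* + m) (sym (ℕ.+-identityʳ (suc d)))))

q≤∣↥q∣ : ∀ q → q ℚ.≤ ℕ→ℚ ℤ.∣ ↥ q ∣
q≤∣↥q∣ q@(mkℚ -[1+ n ] _ _) = ≤-trans (<⇒≤ (negative⁻¹ q)) (ℕ→ℚ-nonNeg (suc n))
q≤∣↥q∣ q@(mkℚ (+ n)    d _) = begin
  q                ≡⟨ sym (*-identityˡ q) ⟩
  1ℚ * q           ≤⟨ *-monoʳ-≤-nonNeg q (ℕ→ℚ-mono-≤ {1} {suc d} (s≤s z≤n)) ⟩
  ℕ→ℚ (suc d) * q  ≡⟨ ↧*q≡↥ q ⟩
  ℕ→ℚ n            ∎
  where open ≤-Reasoning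

1≤↧*q : ∀ {q} → 0ℚ ℚ.< q → 1ℚ ℚ.≤ ℕ→ℚ (↧ₙ q) * q
1≤↧*q {q@(mkℚ +[1+ n ] _ _)} _ = subst (1ℚ ℚ.≤_) (sym (↧*q≡↥ q)) (ℕ→ℚ-mono-≤ {1} {suc n} (s≤s z≤n))
1≤↧*q {mkℚ (+ 0)    _ _} (*<* 0<0) = contradiction 0<0 (ℤ.<-irrefl refl)
1≤↧*q {mkℚ -[1+ n ] _ _} (*<* ())

<-dominate : ∀ {x} y {K D} → 0ℚ ℚ.< x → ℤ.∣ ↥ y ∣ ≤ K → ↧ₙ x ≤ D → y ℚ.< ℕ→ℚ (suc K ℕ.* D) * x
<-dominate {x} y {K} {D} 0<x ∣↥y∣≤K ↧x≤D = begin-strict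
  y
    ≤⟨ q≤∣↥q∣ y ⟩
  ℕ→ℚ ℤ.∣ ↥ y ∣
    ≤⟨ ℕ→ℚ-mono-≤ ∣↥y∣≤K ⟩
  ℕ→ℚ K
    <⟨ ℤ→ℚ-mono-< {+ K} {+ suc K} (ℤ.+<+ (ℕ.n<1+n K)) ⟩
  ℕ→ℚ (suc K)
    ≡⟨ sym (*-identityʳ _) ⟩
  ℕ→ℚ (suc K) * 1ℚ
    ≤⟨ *-monoˡ-≤-nonNeg (ℕ→ℚ (suc K)) {{nonNegative (ℕ→ℚ-nonNeg (suc K))}} (1≤↧*q 0<x) ⟩
  ℕ→ℚ (suc K) * (ℕ→ℚ (↧ₙ x) * x)
    ≤⟨ *-monoˡ-≤-nonNeg (ℕ→ℚ (suc K)) {{nonNegative (ℕ→ℚ-nonNeg (suc K))}}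
         (*-monoʳ-≤-nonNeg x {{nonNegative (<⇒≤ 0<x)}} (ℕ→ℚ-mono-≤ ↧x≤D)) ⟩
  ℕ→ℚ (suc K) * (ℕ→ℚ D * x)
    ≡⟨ sym (*-assoc (ℕ→ℚ (suc K)) (ℕ→ℚ D) x) ⟩
  ℕ→ℚ (suc K) * ℕ→ℚ D * x
    ≡⟨ cong (_* x) (sym (ℕ→ℚ-* (suc K) D)) ⟩
  ℕ→ℚ (suc K ℕ.* D) * x ∎
  where open ≤-Reasoning

sgn-dominant : ∀ {x} y {K D} → x ≢ 0ℚ → ℤ.∣ ↥ y ∣ ≤ K → ↧ₙ x ≤ D →
               sgn (ℕ→ℚ (suc K ℕ.* D) * x + y) ≡ sgn x
sgn-dominant {x} y {K} {D} x≢0 ∣↥y∣≤K ↧x≤D with <-cmp x 0ℚ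
... | tri< x<0 _ _ = trans (sgn-neg Mx+y<0) (sym (sgn-neg x<0))
  where
  M = ℕ→ℚ (suc K ℕ.* D)
  y<-Mx : y ℚ.< - (M * x)
  y<-Mx = subst (y ℚ.<_) (sym (neg-distribʳ-* M x))
            (<-dominate y (neg-antimono-< x<0) ∣↥y∣≤K (subst (_≤ D) (sym (cong ℤ.∣_∣ (↧-neg x))) ↧x≤D))
  Mx+y<0 : M * x + y ℚ.< 0ℚ
  Mx+y<0 = subst (M * x + y ℚ.<_) (+-inverseʳ (M * x)) (+-monoʳ-< (M * x) y<-Mx)
... | tri≈ _ x≡0 _ = contradiction x≡0 x≢0
... | tri> _ _ 0<x = trans (sgn-pos 0<Mx+y) (sym (sgn-pos 0<x))
  where
  M = ℕ→ℚ (suc K ℕ.* D)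
  ∣↥-y∣≤K : ℤ.∣ ↥ (- y) ∣ ≤ K
  ∣↥-y∣≤K = subst (_≤ K) (sym (trans (cong ℤ.∣_∣ (↥-neg y)) (ℤ.∣-i∣≡∣i∣ (↥ y)))) ∣↥y∣≤K
  0<Mx+y : 0ℚ ℚ.< M * x + y
  0<Mx+y = subst (ℚ._< M * x + y) (+-inverseˡ y) (+-monoˡ-< y (<-dominate (- y) 0<x ∣↥-y∣≤K ↧x≤D))

^ℚ-pos : ∀ {x} n → 0ℚ ℚ.< x → 0ℚ ℚ.< x ^ℚ n
^ℚ-pos zero    0<x = positive⁻¹ 1ℚ
^ℚ-pos {x} (suc n) 0<x =
  positive⁻¹ (x * x ^ℚ n) {{pos*pos⇒pos x {{positive 0<x}} (x ^ℚ n) {{positive (^ℚ-pos n 0<x)}}}}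

prismCoeffs-suc : ∀ a b d c j → prismCoeffs a b d c (suc j) ≡
  ℕ→ℚ a ^ℚ j * (ℕ→ℚ a * coeffSeq d c (suc j) + ℕ→ℚ b * coeffSeq d c j)
prismCoeffs-suc a b d c j = solve 5 (λ e₁ e₀ A B p → e₁ :* (A :* p) :+ B :* (e₀ :* p) := p :* (A :* e₁ :+ B :* e₀))
  refl (coeffSeq d c (suc j)) (coeffSeq d c j) (ℕ→ℚ a) (ℕ→ℚ b) (ℕ→ℚ a ^ℚ j)

maxUpTo : (ℕ → ℕ) → ℕ → ℕ
maxUpTo f zero    = f 0
maxUpTo f (suc n) = maxUpTo f n ℕ.⊔ f (suc n)

≤-maxUpTo : ∀ f {i n} → i ≤ n → f i ≤ maxUpTo f n
≤-maxUpTo f {n = zero}  z≤n = ℕ.≤-refl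
≤-maxUpTo f {n = suc n} i≤1+n with ℕ.m≤n⇒m<n∨m≡n i≤1+n
... | inj₁ (s≤s i≤n) = ℕ.≤-trans (≤-maxUpTo f i≤n) (ℕ.m≤m⊔n _ _)
... | inj₂ refl      = ℕ.m≤n⊔m _ _

module _ (d : ℕ) (c : ℕ → ℚ) where

  private
    e = coeffSeq d c
    K = maxUpTo (λ i → ℤ.∣ ↥ e i ∣) (suc d)
    D = maxUpTo (λ i → ↧ₙ e i) (suc d)

  -- M|eᵢ| > |eⱼ| whenever eᵢ ≠ 0, as |eⱼ| ≤ K and |eᵢ| ≥ 1/D.
  scale : ℕ
  scale = suc K ℕ.* suc D

  private
    M = ℕ→ℚ scale

    0<M : 0ℚ ℚ.< M
    0<M = ℕ→ℚ-pos (ℕ.pred scale)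

    sgn-M*eᵢ+eⱼ : ∀ {i j} → i ≤ suc d → j ≤ suc d → e i ≢ 0ℚ → sgn (M * e i + e j) ≡ sgn (e i)
    sgn-M*eᵢ+eⱼ i≤ j≤ eᵢ≢0 = sgn-dominant _ eᵢ≢0
      (≤-maxUpTo (λ i → ℤ.∣ ↥ e i ∣) j≤) (ℕ.m≤n⇒m≤1+n (≤-maxUpTo (λ i → ↧ₙ e i) i≤))

    sgn-M*eᵢ+eⱼ≡sgn-cᵢ : (∀ i → 1 ≤ i → i ≤ d → c i ≢ 0ℚ) →
                          ∀ {i j} → 1 ≤ i → i ≤ d → j ≤ suc d → sgn (M * e i + e j) ≡ sgn (c i)
    sgn-M*eᵢ+eⱼ≡sgn-cᵢ c≢0 {i} 1≤i i≤d j≤ = trans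
      (sgn-M*eᵢ+eⱼ (ℕ.m≤n⇒m≤1+n i≤d) j≤ (subst (_≢ 0ℚ) (sym eᵢ≡cᵢ) (c≢0 i 1≤i i≤d)))
      (cong sgn eᵢ≡cᵢ)
      where eᵢ≡cᵢ = coeffSeq-≤ d c i 1≤i i≤d

  sgn-prismCoeffs-scale-1 : (∀ i → 1 ≤ i → i ≤ d → c i ≢ 0ℚ) →
    ∀ i → 1 ≤ i → i < d → sgn (prismCoeffs scale 1 d c i) ≡ sgn (c i)
  sgn-prismCoeffs-scale-1 c≢0 (suc j) 1≤i i<d = begin
    sgn (prismCoeffs scale 1 d c (suc j))
      ≡⟨ cong sgn (prismCoeffs-suc scale 1 d c j) ⟩
    sgn (M ^ℚ j * (M * e (suc j) + 1ℚ * e j))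
      ≡⟨ sgn-*-pos _ (^ℚ-pos j 0<M) ⟩
    sgn (M * e (suc j) + 1ℚ * e j)
      ≡⟨ cong (λ x → sgn (M * e (suc j) + x)) (*-identityˡ (e j)) ⟩
    sgn (M * e (suc j) + e j)
      ≡⟨ sgn-M*eᵢ+eⱼ≡sgn-cᵢ c≢0 1≤i i≤d (ℕ.≤-trans (ℕ.n≤1+n j) (ℕ.m≤n⇒m≤1+n i≤d)) ⟩
    sgn (c (suc j)) ∎
    where
    open ≡-Reasoning
    i≤d = ℕ.<⇒≤ i<d

  prismCoeffs-1-suc : ∀ b j → prismCoeffs 1 b d c (suc j) ≡ ℕ→ℚ b * e j + e (suc j)
  prismCoeffs-1-suc b j = begin
    prismCoeffs 1 b d c (suc j)
      ≡⟨ prismCoeffs-suc 1 b d c j ⟩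
    1ℚ ^ℚ j * (1ℚ * e (suc j) + ℕ→ℚ b * e j)
      ≡⟨ cong (_* (1ℚ * e (suc j) + ℕ→ℚ b * e j)) (1^n≡1 j) ⟩
    1ℚ * (1ℚ * e (suc j) + ℕ→ℚ b * e j)
      ≡⟨ solve 3 (λ x y B → con 1ℚ :* (con 1ℚ :* y :+ B :* x) := B :* x :+ y) refl (e j) (e (suc j)) (ℕ→ℚ b) ⟩
    ℕ→ℚ b * e j + e (suc j) ∎
    where open ≡-Reasoning

  sgn-prismCoeffs-1-scale : (∀ i → 1 ≤ i → i ≤ d → c i ≢ 0ℚ) →
    ∀ i → 2 ≤ i → i < d → sgn (prismCoeffs 1 scale d c i) ≡ sgn (c (i ∸ 1))
  sgn-prismCoeffs-1-scale c≢0 (suc (suc j)) (s≤s 1≤1+j) i<d =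
    trans (cong sgn (prismCoeffs-1-suc scale (suc j)))
          (sgn-M*eᵢ+eⱼ≡sgn-cᵢ c≢0 1≤1+j (ℕ.≤-trans (ℕ.n≤1+n (suc j)) i≤d) (ℕ.m≤n⇒m≤1+n i≤d))
    where i≤d = ℕ.<⇒≤ i<d

  sgn-prismCoeffs-1-scale-1 : sgn (prismCoeffs 1 scale d c 1) ≡ + 1
  sgn-prismCoeffs-1-scale-1 =
    trans (cong sgn (prismCoeffs-1-suc scale 0)) (sgn-M*eᵢ+eⱼ z≤n (s≤s z≤n) (λ ()))

theorem5p1 : (N k d : ℕ) (V : Vec (Vec ℤ N) (suc k)) (c : ℕ → ℚ) →
    HasDim V d → HasEhrhart V d c →
    (∀ i → 1 ≤ i → i ≤ d → c i ≢ 0ℚ) →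
    (Σ (ℕ → ℚ) λ h → IntegralPolytopeWithEhrhart (suc d) h ×
       (∀ i → 1 ≤ i → i < d → sgn (h i) ≡ sgn (c i)))
    × (Σ (ℕ → ℚ) λ g → IntegralPolytopeWithEhrhart (suc d) g ×
       (∀ i → 2 ≤ i → i < d → sgn (g i) ≡ sgn (c (i ∸ 1)))
       × sgn (g 1) ≡ + 1)
theorem5p1 N k d V c dimV ehrV c≢0 =
  (prismCoeffs M 1 d c , Q₁ , sgn-prismCoeffs-scale-1 d c c≢0) ,
  (prismCoeffs 1 M d c , Q₂ , sgn-prismCoeffs-1-scale d c c≢0 , sgn-prismCoeffs-1-scale-1 d c)
  where
  M = scale d c
  m = ℕ.pred M
  Q₁ : IntegralPolytopeWithEhrhart (suc d) (prismCoeffs M 1 d c)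
  Q₁ = suc N , k ℕ.+ suc k , prism M 1 V , hasDim-prism m 0 V dimV , hasEhrhart-prism m 0 V d c ehrV
  Q₂ : IntegralPolytopeWithEhrhart (suc d) (prismCoeffs 1 M d c)
  Q₂ = suc N , k ℕ.+ suc k , prism 1 M V , hasDim-prism 0 m V dimV , hasEhrhart-prism 0 m V d c ehrV
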